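{- Let $m,n,s,k$ be positive integers with $m+s=n+k$, and let $\mathbf a=(a_1,\ldots,a_s)$, $\mathbf d=(d_1,\ldots,d_m)$, $\mathbf b=(b_1,\ldots,b_k)$, $\mathbf c=(c_1,\ldots,c_n)$ be partitions with $c_i\ne d_j$ for all $i,j$. With $S,\Delta$, $c^{h'}$ and $q_j$ as in the context, suppose $c^{h'}\ge a_s$, and let $j\in\{1,\ldots,m\}$ satisfy $d_j>c^{h'}$. Then $q_j\le s$. Moreover, if $j\notin\Delta$ then $q_j<s$.
   Context: A partition is a finite nonincreasing sequence of integers. Empty sums are $0$; for any sequence $y_1,\ldots,y_w$ one sets $y_i=+\infty$ for $i\le0$ and $y_i=-\infty$ for $i>w$. $\mathbf e$ is the nonincreasing rearrangement of all entries of $\mathbf d$ and $\mathbf a$, where whenever some $d_i$ equals some $a_j$, the $a$'s of that value are placed before the $d$'s of that value; $\mathbf e'$ is defined the same way from $\mathbf c$ and $\mathbf b$ (equal $b$'s before equal $c$'s). Sets $S\subseteq\{1,\ldots,n\}$, $\Delta\subseteq\{1,\ldots,m\}$ are defined inductively: start with $S=\Delta=\emptyset$ and process all entries of $\mathbf c$ and $\mathbf d$ one at a time, from the smallest value to the largest; among equal entries of $\mathbf c$ (resp. $\mathbf d$) the one with the larger index is processed first. All sets and counts below refer to the decisions made so far. If the processed entry is $d_j$: set $q_j=s-\#\{i\in S\mid c_i<d_j\}+\#\{i>j\mid i\notin\Delta\}+1$. If $q_j>s$, put $j\in\Delta$. If $q_j\le s$, let $l\in S$ be the minimal index with $d_j>c_l$,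 and let $N=\#\{i\mid a_i>c_l\}-s+\#\{i\in S\mid i>l\}-\#\{i\notin\Delta\mid d_i<c_l\}+1$. (a) If $N\ge1$ and the entry $d_j$ of $\mathbf e$ is among the $N$ smallest entries of $\mathbf e$ that are larger than $c_l$, put $j\notin\Delta$. (b) Otherwise put $j\notin\Delta$ if $\sum_{i\in S,\,c_i<d_j}c_i\ge\sum_{i\notin\Delta,\,i>j}d_i+d_j+\sum_{i=q_j+1}^{s}a_i$, and $j\in\Delta$ if not. If the processed entry is $c_j$: dually, set $q'_j=k-\#\{i\in\Delta\mid d_i<c_j\}+\#\{i>j\mid i\notin S\}+1$. If $q'_j>k$, put $j\in S$. If $q'_j\le k$, let $l\in\Delta$ be the minimal index with $c_j>d_l$, and $N'=\#\{i\mid b_i>d_l\}-k+\#\{i\in\Delta\mid i>l\}-\#\{i\notin S\mid c_i<d_l\}+1$. (a) If $N'\ge1$ and the entry $c_j$ of $\mathbf e'$ is among the $N'$ smallest entries of $\mathbf e'$ larger than $d_l$, put $j\notin S$. (b) Otherwise put $j\notin S$ if $\sum_{i\in\Delta,\,d_i<c_j}d_i\ge\sum_{i\notin S,\,i>j}c_i+c_j+\sum_{i=q'_j+1}^{k}b_i$, and $j\in S$ if not. $q_j$ denotes the value computed when $d_j$ is processed. Let $h'=|S|$ and let $c^1\ge\cdots\ge c^{h'}$ be the $c_i$ with $i\in S$; by convention $c^0=+\infty$ (so if $h'=0$, $c^{h'}=+\infty$). -}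

module Defs where

open import Data.Bool using (Bool; true; false; not; _∧_; if_then_else_)
open import Data.Nat as ℕ using (ℕ; zero; suc; _∸_)
open import Data.Integer as ℤ using (ℤ; +_; _+_; _-_; _≤ᵇ_; ∣_∣)
open import Data.Fin using (Fin; toℕ; fromℕ)
open import Data.List using (List; []; _∷_; length; map; filterᵇ; allFin; reverse; head; last; drop; foldr; foldl)
open import Data.Bool.ListAction using (any)
open import Data.Maybe using (Maybe; just; nothing)
open import Data.Sum using (_⊎_; inj₁; inj₂)
open import Data.Product using (_×_; _,_; proj₁; proj₂)
open import Data.Unit using (⊤)
open import Data.Empty using (⊥)

-- Basic helpers.  Indices are 0-based (Fin p), values are integers.

_<ℤᵇ_ : ℤ → ℤ → Bool
x <ℤᵇ y = not (y ≤ᵇ x)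

_<ᶠ_ : ∀ {p} → Fin p → Fin p → Bool
i <ᶠ j = toℕ i ℕ.<ᵇ toℕ j

_==ᶠ_ : ∀ {p} → Fin p → Fin p → Bool
i ==ᶠ j = toℕ i ℕ.≡ᵇ toℕ j

Partition : ∀ {p} → (Fin p → ℤ) → Set
Partition {p} x = ∀ (i j : Fin p) → toℕ i ℕ.≤ toℕ j → x j ℤ.≤ x i

cnt : ∀ {p} → (Fin p → Bool) → ℕ
cnt {p} P = length (filterᵇ P (allFin p))

sumℤ : List ℤ → ℤ
sumℤ = foldr _+_ (+ 0)

sumOver : ∀ {p} → (Fin p → Bool) → (Fin p → ℤ) → ℤ
sumOver {p} P f = sumℤ (map f (filterᵇ P (allFin p)))

upd : ∀ {p} {A : Set} → (Fin p → A) → Fin p → A → (Fin p → A)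
upd f j v i = if i ==ᶠ j then v else f i

-- the last index (1-based index p) of a nonempty index set
lastIx : ∀ {p} → 0 ℕ.< p → Fin p
lastIx {suc p} _ = fromℕ p

-- Extended integers ℤ ∪ {+∞}:  nothing = +∞.

_≥∞_ : Maybe ℤ → ℤ → Set
nothing ≥∞ y = ⊤
just x  ≥∞ y = y ℤ.≤ x

_>∞_ : ℤ → Maybe ℤ → Set
y >∞ nothing = ⊥
y >∞ just x  = x ℤ.< y

-- The sequence e: nonincreasing rearrangement of the entries of the
-- "auxiliary" sequence z (a, resp. b) and the "own" sequence x
-- (d, resp. c); entries are tagged by their origin, inj₁ i = z_i,
-- inj₂ i = x_i.  On ties the z-entries come first; within z and within
-- x the original (index) order is kept.

mergeDesc : ∀ {t p} → (Fin t → ℤ) → (Fin p → ℤ) →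
            List (Fin t) → List (Fin p) → List (Fin t ⊎ Fin p)
mergeDesc z x []       ys       = map inj₂ ys
mergeDesc z x (u ∷ us) []       = map inj₁ (u ∷ us)
mergeDesc z x (u ∷ us) (v ∷ vs) =
  if x v ≤ᵇ z u then inj₁ u ∷ mergeDesc z x us (v ∷ vs)
                else inj₂ v ∷ mergeDesc z x (u ∷ us) vs

eSeq : ∀ {t p} → (Fin t → ℤ) → (Fin p → ℤ) → List (Fin t ⊎ Fin p)
eSeq {t} {p} z x = mergeDesc z x (allFin t) (allFin p)

eVal : ∀ {t p} → (Fin t → ℤ) → (Fin p → ℤ) → Fin t ⊎ Fin p → ℤ
eVal z x (inj₁ i) = z i
eVal z x (inj₂ i) = x i

-- the last N elements of a list (i.e. the N smallest, for a
-- nonincreasing list)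
lastN : ∀ {A : Set} → ℕ → List A → List A
lastN N xs = drop (length xs ∸ N) xs

isOwn : ∀ {t p} → Fin p → Fin t ⊎ Fin p → Bool
isOwn j (inj₁ _) = false
isOwn j (inj₂ i) = i ==ᶠ j

-- One decision step, written generically.
--   own sequence x (length p) with its set X   (d, Δ  resp.  c, S)
--   other sequence y (length r) with its set Y (c, S  resp.  d, Δ)
--   auxiliary sequence z (length t)            (a, s  resp.  b, k)
-- Returns (q_j , whether j is put into X).

-- Σ_{i = q+1}^{t} z_i  (1-based), as an element of ℤ ∪ {+∞}:
-- for q ≤ -1 the range contains i = 0 where z_0 = +∞.
tailSum : ∀ {t} → (Fin t → ℤ) → ℤ → Maybe ℤ
tailSum z (+ q)    = just (sumOver (λ i → q ℕ.≤ᵇ toℕ i) z)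
tailSum z ℤ.-[1+ _ ] = nothing

geᵇ : ℤ → Maybe ℤ → Bool
geᵇ lhs nothing    = false
geᵇ lhs (just rhs) = rhs ≤ᵇ lhs

decide : ∀ {p r t} → (x : Fin p → ℤ) (y : Fin r → ℤ) (z : Fin t → ℤ)
         (X : Fin p → Bool) (Y : Fin r → Bool) (j : Fin p) → ℤ × Bool
decide {p} {r} {t} x y z X Y j =
    q , (if (+ t) <ℤᵇ q then true else caseL (head (filterᵇ below (allFin r))))
  where
    below : Fin r → Bool
    below i = Y i ∧ (y i <ℤᵇ x j)

    q : ℤ
    q = + t - + cnt below + + cnt (λ i → (j <ᶠ i) ∧ not (X i)) + + 1

    -- given l (the minimal index in Y with x_j > y_l)
    inX : Fin r → Bool
    inX l = if condA then false else not condB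
      where
        N : ℤ
        N = + cnt (λ i → y l <ℤᵇ z i) - + t
            + + cnt (λ i → Y i ∧ (l <ᶠ i))
            - + cnt (λ i → not (X i) ∧ (x i <ℤᵇ y l)) + + 1
        -- (a): N ≥ 1 and x_j is among the N smallest entries of e
        --      that are larger than y_l
        condA : Bool
        condA = (+ 1 ≤ᵇ N) ∧
                any (isOwn j) (lastN ∣ N ∣ (filterᵇ (λ e → y l <ℤᵇ eVal z x e) (eSeq z x)))
        -- (b): Σ_{i∈Y, y_i<x_j} y_i ≥ Σ_{i∉X, i>j} x_i + x_j + Σ_{i=q+1}^{t} z_i
        rhs : Maybe ℤ
        rhs with tailSum z q
        ... | nothing = nothing
        ... | just w  = just (sumOver (λ i → (j <ᶠ i) ∧ not (X i)) x + x j + w)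
        condB : Bool
        condB = geᵇ (sumOver below y) rhs

    -- if q ≤ t, such an l exists; the 'nothing' branch is unreachable
    caseL : Maybe (Fin r) → Bool
    caseL nothing  = true
    caseL (just l) = inX l

record State (n m : ℕ) : Set where
  constructor st
  field
    S  : Fin n → Bool
    Δ  : Fin m → Bool
    qd : Fin m → ℤ      -- q_j, recorded when d_j is processed

-- processing order: all entries of c and d from the smallest value to the
-- largest; among equal entries of c (resp. d) the larger index first.
-- inj₁ i = c_i, inj₂ j = d_j.  (c_i ≠ d_j, so c- and d-entries never tie.)
mergeAsc : ∀ {n m} → (Fin n → ℤ) → (Fin m → ℤ) →
           List (Fin n) → List (Fin m) → List (Fin n ⊎ Fin m)
mergeAsc c d []       ys       = map inj₂ ys
mergeAsc c d (u ∷ us) []       = map inj₁ (u ∷ us)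
mergeAsc c d (u ∷ us) (v ∷ vs) =
  if c u ≤ᵇ d v then inj₁ u ∷ mergeAsc c d us (v ∷ vs)
                else inj₂ v ∷ mergeAsc c d (u ∷ us) vs

order : ∀ {n m} → (Fin n → ℤ) → (Fin m → ℤ) → List (Fin n ⊎ Fin m)
order {n} {m} c d = mergeAsc c d (reverse (allFin n)) (reverse (allFin m))

step : ∀ {n m s k} → (a : Fin s → ℤ) (d : Fin m → ℤ) (b : Fin k → ℤ) (c : Fin n → ℤ) →
       State n m → Fin n ⊎ Fin m → State n m
step a d b c (st S Δ qd) (inj₁ j) =
  st (upd S j (proj₂ (decide c d b S Δ j))) Δ qd
step a d b c (st S Δ qd) (inj₂ j) =
  let r = decide d c a Δ S j in
  st S (upd Δ j (proj₂ r)) (upd qd j (proj₁ r))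

construction : ∀ {n m s k} → (a : Fin s → ℤ) (d : Fin m → ℤ) (b : Fin k → ℤ) (c : Fin n → ℤ) →
               State n m
construction a d b c = foldl (step a d b c) (st (λ _ → false) (λ _ → false) (λ _ → + 0)) (order c d)

-- c^{h'}: the last (smallest) of c^1 ≥ ... ≥ c^{h'} (the c_i, i ∈ S);
-- +∞ (= nothing) if S = ∅.
cLast : ∀ {n} → (c : Fin n → ℤ) → (S : Fin n → Bool) → Maybe ℤ
cLast {n} c S = last (map c (filterᵇ S (allFin n)))

-- Fix j with d_j > c^{h'} and count A(j) = #{l ∈ S | c_l < d_j}, B(j) = #{i > j | i ∉ Δ} and
-- F(j) = #{i ≥ j | i ∉ Δ}.  The sets S and Δ never change on entries processed before d_j, so
-- q_j = s − A(j) + B(j) + 1 and the claim reads B(j) < A(j), resp. B(j) + 1 < A(j) if j ∉ Δ.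
-- Leaving j out of Δ forces q_j ≤ s, i.e. B(j) < A(j); a downward induction then gives
-- F(i) ≤ A(i) or F(i) = 0 for every i.  The heart of the proof excludes the tie A(j) = B(j) + 1
-- for j ∉ Δ: then q_j = s, and rule (b) would need Σ_{c_l < d_j, l ∈ S} c_l to dominate
-- Σ_{i ≥ j, i ∉ Δ} d_i, although both sums have the same number of terms and each such d_i
-- exceeds at least as many of those c_l as there are such d's from d_i on; rule (a) fails
-- because the tie and a_s ≤ c^{h'} ≤ c_l bound N by the number of d_i > c_l with i > j, while
-- (a) places d_j among the N smallest entries of e above c_l.  Since A jumps as d crosses
-- c^{h'}, a second downward induction over the j with d_j > c^{h'} yields F(j) < A(j), which is
-- the claim.

module Submission where

open import Defs
open import Algebra.Bundles using (CommutativeMonoid)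
open import Data.Bool using (Bool; true; false; not; _∧_; if_then_else_; T)
open import Data.Bool.ListAction using (any)
open import Data.Bool.Properties
  using (T-∧; T-≡; T-not-≡; not-injective; ∧-identityʳ; ∧-zeroʳ; ∧-commutativeMonoid)
open import Data.Empty using (⊥; ⊥-elim)
open import Data.Fin as F using (Fin; toℕ; fromℕ; inject₁)
import Data.Fin.Induction as FI
import Data.Fin.Properties as FP
open import Data.Integer as ℤ using (ℤ; +_; _+_; _-_; -_; _≤ᵇ_; ∣_∣)
import Data.Integer.Properties as ℤP
open import Data.Integer.Tactic.RingSolver using (solve-∀)
open import Data.List
  using (List; []; _∷_; _++_; length; map; filterᵇ; allFin; tabulate; mapMaybe; take; drop; reverse; foldl; head; last)
import Data.List.Properties as LP
open import Data.List.Membership.Propositional using (_∈_; find)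
open import Data.List.Membership.Propositional.Properties using (∈-∃++; ∈-allFin; ∈-filter⁺; ∈-filter⁻)
open import Data.List.Relation.Unary.All as All using (All; []; _∷_)
import Data.List.Relation.Unary.All.Properties as AllP
open import Data.List.Relation.Unary.AllPairs using (AllPairs; []; _∷_)
import Data.List.Relation.Unary.AllPairs.Properties as AllPairsP
open import Data.List.Relation.Unary.Any as Any using (here; there)
import Data.List.Relation.Unary.Any.Properties as AnyP
open import Data.Maybe using (just)
open import Data.Maybe.Properties using (just-injective)
open import Data.Nat as ℕ using (ℕ; zero; suc; z≤n; s≤s; _∸_)
import Data.Nat.Properties as ℕP
open import Data.Product as Product using (_×_; _,_; proj₁; proj₂; ∃)
open import Data.Sum using (_⊎_; inj₁; inj₂; isInj₂)
open import Function using (_∘_; flip; Equivalence)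
open import Induction.WellFounded using (Acc; acc)
open import Relation.Binary.Definitions using (tri<; tri≈; tri>)
open import Relation.Binary.PropositionalEquality
open import Relation.Nullary using (¬_; yes; no)
open import Relation.Nullary.Decidable using (T?)

open import Algebra.Properties.CommutativeSemigroup ℕP.+-commutativeSemigroup
  using () renaming (interchange to +-interchange; x∙yz≈y∙xz to ℕ-+-left-swap)
open import Algebra.Properties.CommutativeSemigroup ℤP.+-commutativeSemigroup
  using () renaming (x∙yz≈y∙xz to +-left-swap)
open import Algebra.Properties.CommutativeSemigroup (CommutativeMonoid.commutativeSemigroup ∧-commutativeMonoid)
  using () renaming (xy∙z≈xz∙y to ∧-right-swap)

T-∧⁻ : ∀ {x y} → T (x ∧ y) → T x × T y
T-∧⁻ = Equivalence.to T-∧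

T-∧⁺ : ∀ {x y} → T x → T y → T (x ∧ y)
T-∧⁺ tx ty = Equivalence.from T-∧ (tx , ty)

T-not⁺ : ∀ {x} → ¬ T x → T (not x)
T-not⁺ {false} _ = _
T-not⁺ {true} ¬t = ¬t _

T-not⁻ : ∀ {x} → T (not x) → ¬ T x
T-not⁻ {false} _ ()

T-injective : ∀ {x y} → (T x → T y) → (T y → T x) → x ≡ y
T-injective {false} {false} _ _ = refl
T-injective {false} {true} _ y⇒x = ⊥-elim (y⇒x _)
T-injective {true} {false} x⇒y _ = ⊥-elim (x⇒y _)
T-injective {true} {true} _ _ = refl

∧-congˡ : ∀ {x x′ y : Bool} → (T y → x ≡ x′) → x ∧ y ≡ x′ ∧ y
∧-congˡ {x} {x′} {true} x≡x′ = trans (∧-identityʳ x) (trans (x≡x′ _) (sym (∧-identityʳ x′)))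
∧-congˡ {x} {x′} {false} _ = trans (∧-zeroʳ x) (sym (∧-zeroʳ x′))

∧-congʳ : ∀ {x y y′ : Bool} → (T x → y ≡ y′) → x ∧ y ≡ x ∧ y′
∧-congʳ {true} y≡y′ = y≡y′ _
∧-congʳ {false} _ = refl

<ℤᵇ⇒< : ∀ {x y} → T (x <ℤᵇ y) → x ℤ.< y
<ℤᵇ⇒< t = ℤP.≰⇒> (T-not⁻ t ∘ ℤP.≤⇒≤ᵇ)

<⇒<ℤᵇ : ∀ {x y} → x ℤ.< y → T (x <ℤᵇ y)
<⇒<ℤᵇ x<y = T-not⁺ (ℤP.<⇒≱ x<y ∘ ℤP.≤ᵇ⇒≤)

-- The indices are explicit: unification cannot recover them through toℕ.
<ᶠ⇒< : ∀ {p} (i j : Fin p) → T (i <ᶠ j) → i F.< j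
<ᶠ⇒< i j = ℕP.<ᵇ⇒< (toℕ i) (toℕ j)

<⇒<ᶠ : ∀ {p} (i j : Fin p) → i F.< j → T (i <ᶠ j)
<⇒<ᶠ i j = ℕP.<⇒<ᵇ

==ᶠ⇒≡ : ∀ {p} (i j : Fin p) → T (i ==ᶠ j) → i ≡ j
==ᶠ⇒≡ i j t = FP.toℕ-injective (ℕP.≡ᵇ⇒≡ (toℕ i) (toℕ j) t)

==ᶠ-refl : ∀ {p} (i : Fin p) → T (i ==ᶠ i)
==ᶠ-refl i = ℕP.≡⇒≡ᵇ (toℕ i) (toℕ i) refl

_≤ᶠ_ : ∀ {p} → Fin p → Fin p → Bool
i ≤ᶠ j = toℕ i ℕ.≤ᵇ toℕ j

≤ᶠ⇒≤ : ∀ {p} (i j : Fin p) → T (i ≤ᶠ j) → i F.≤ j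
≤ᶠ⇒≤ i j = ℕP.≤ᵇ⇒≤ (toℕ i) (toℕ j)

≤⇒≤ᶠ : ∀ {p} (i j : Fin p) → i F.≤ j → T (i ≤ᶠ j)
≤⇒≤ᶠ i j = ℕP.≤⇒≤ᵇ

Fin-downward-induction : ∀ {m} (P : Fin m → Set) →
                         (∀ i → (∀ i′ → toℕ i′ ≡ suc (toℕ i) → P i′) → P i) → ∀ i → P i
Fin-downward-induction P step i = go i (FI.>-wellFounded i)
  where
  go : ∀ i → Acc F._>_ i → P i
  go i (acc rec) = step i (λ i′ i′≡ → go i′ (rec (ℕP.≤-reflexive (sym i′≡))))

last-or-next : ∀ {m} (i : Fin m) → suc (toℕ i) ≡ m ⊎ ∃ λ i′ → toℕ i′ ≡ suc (toℕ i)
last-or-next {m} i with suc (toℕ i) ℕ.<? m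
... | yes 1+i<m = inj₂ (F.fromℕ< 1+i<m , FP.toℕ-fromℕ< 1+i<m)
... | no 1+i≮m = inj₁ (ℕP.≤-antisym (FP.toℕ<n i) (ℕP.≮⇒≥ 1+i≮m))

upd-same : ∀ {p} {A : Set} (f : Fin p → A) (j : Fin p) (v : A) → upd f j v j ≡ v
upd-same f j v with j ==ᶠ j in eq
... | true = refl
... | false = ⊥-elim (subst T eq (==ᶠ-refl j))

upd-other : ∀ {p} {A : Set} (f : Fin p → A) (j : Fin p) (v : A) {i : Fin p} → i ≢ j → upd f j v i ≡ f i
upd-other f j v {i} i≢j with i ==ᶠ j in eq
... | true = ⊥-elim (i≢j (==ᶠ⇒≡ i j (subst T (sym eq) _)))
... | false = refl

-- Counting and summing over Fin

_⊆_ : ∀ {p} → (Fin p → Bool) → (Fin p → Bool) → Set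
P ⊆ Q = ∀ i → T (P i) → T (Q i)

_∖_ : ∀ {p} → (Fin p → Bool) → Fin p → (Fin p → Bool)
(P ∖ l) i = P i ∧ not (i ==ᶠ l)

⟦_⟧ : Bool → ℕ
⟦ true ⟧ = 1
⟦ false ⟧ = 0

count : ∀ {p} → (Fin p → Bool) → ℕ
count {zero} P = 0
count {suc p} P = ⟦ P F.zero ⟧ ℕ.+ count (P ∘ F.suc)

sumWhere : ∀ {p} → (Fin p → Bool) → (Fin p → ℤ) → ℤ
sumWhere {zero} P f = + 0
sumWhere {suc p} P f = (if P F.zero then f F.zero else + 0) + sumWhere (P ∘ F.suc) (f ∘ F.suc)

length-filter-tabulate : ∀ {p} {A : Set} (P : A → Bool) (g : Fin p → A) →
                         length (filterᵇ P (tabulate g)) ≡ count (P ∘ g)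
length-filter-tabulate {zero} P g = refl
length-filter-tabulate {suc p} P g with P (g F.zero)
... | true = cong suc (length-filter-tabulate P (g ∘ F.suc))
... | false = length-filter-tabulate P (g ∘ F.suc)

sum-filter-tabulate : ∀ {p} {A : Set} (P : A → Bool) (f : A → ℤ) (g : Fin p → A) →
                      sumℤ (map f (filterᵇ P (tabulate g))) ≡ sumWhere (P ∘ g) (f ∘ g)
sum-filter-tabulate {zero} P f g = refl
sum-filter-tabulate {suc p} P f g with P (g F.zero)
... | true = cong (λ w → f (g F.zero) + w) (sum-filter-tabulate P f (g ∘ F.suc))
... | false = trans (sum-filter-tabulate P f (g ∘ F.suc)) (sym (ℤP.+-identityˡ _))

cnt≡count : ∀ {p} (P : Fin p → Bool) → cnt P ≡ count P
cnt≡count P = length-filter-tabulate P (λ i → i)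

sumOver≡sumWhere : ∀ {p} (P : Fin p → Bool) (f : Fin p → ℤ) → sumOver P f ≡ sumWhere P f
sumOver≡sumWhere P f = sum-filter-tabulate P f (λ i → i)

⟦⟧-mono : ∀ {x y} → (T x → T y) → ⟦ x ⟧ ℕ.≤ ⟦ y ⟧
⟦⟧-mono {false} _ = z≤n
⟦⟧-mono {true} {true} _ = ℕP.≤-refl
⟦⟧-mono {true} {false} f = ⊥-elim (f _)

⟦⟧-false : ∀ {x} → ¬ T x → ⟦ x ⟧ ≡ 0
⟦⟧-false {false} _ = refl
⟦⟧-false {true} ¬t = ⊥-elim (¬t _)

count-mono : ∀ {p} {P Q : Fin p → Bool} → P ⊆ Q → count P ℕ.≤ count Q
count-mono {zero} _ = z≤n
count-mono {suc p} P⊆Q = ℕP.+-mono-≤ (⟦⟧-mono (P⊆Q F.zero)) (count-mono (P⊆Q ∘ F.suc))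

count-cong : ∀ {p} {P Q : Fin p → Bool} → P ⊆ Q → Q ⊆ P → count P ≡ count Q
count-cong P⊆Q Q⊆P = ℕP.≤-antisym (count-mono P⊆Q) (count-mono Q⊆P)

count-cong-≡ : ∀ {p} {P Q : Fin p → Bool} → (∀ i → P i ≡ Q i) → count P ≡ count Q
count-cong-≡ P≡Q = count-cong (λ i → subst T (P≡Q i)) (λ i → subst T (sym (P≡Q i)))

count-union : ∀ {p} {P Q R : Fin p → Bool} → (∀ i → T (P i) → T (Q i) ⊎ T (R i)) →
              count P ℕ.≤ count Q ℕ.+ count R
count-union {zero} _ = z≤n
count-union {suc p} {P} {Q} {R} split = begin
  ⟦ P F.zero ⟧ ℕ.+ count (P ∘ F.suc)
    ≤⟨ ℕP.+-mono-≤ (⟦⟧-union (split F.zero)) (count-union (split ∘ F.suc)) ⟩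
  (⟦ Q F.zero ⟧ ℕ.+ ⟦ R F.zero ⟧) ℕ.+ (count (Q ∘ F.suc) ℕ.+ count (R ∘ F.suc))
    ≡⟨ +-interchange ⟦ Q F.zero ⟧ _ _ _ ⟩
  (⟦ Q F.zero ⟧ ℕ.+ count (Q ∘ F.suc)) ℕ.+ (⟦ R F.zero ⟧ ℕ.+ count (R ∘ F.suc)) ∎
  where
  open ℕP.≤-Reasoning
  ⟦⟧-union : ∀ {x y z} → (T x → T y ⊎ T z) → ⟦ x ⟧ ℕ.≤ ⟦ y ⟧ ℕ.+ ⟦ z ⟧
  ⟦⟧-union {false} _ = z≤n
  ⟦⟧-union {true} {true} _ = s≤s z≤n
  ⟦⟧-union {true} {false} {true} _ = s≤s z≤n
  ⟦⟧-union {true} {false} {false} f with f _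
  ... | inj₁ ()
  ... | inj₂ ()

count-remove : ∀ {p} (P : Fin p → Bool) {l : Fin p} → T (P l) → count P ≡ suc (count (P ∖ l))
count-remove {suc p} P {F.zero} Pl with P F.zero
... | true = cong suc (count-cong (λ i t → T-∧⁺ {P (F.suc i)} {true} t _) (λ i → proj₁ ∘ T-∧⁻ {P (F.suc i)}))
count-remove {suc p} P {F.suc l} Pl = begin
  ⟦ P F.zero ⟧ ℕ.+ count (P ∘ F.suc)                 ≡⟨ cong₂ ℕ._+_ (cong ⟦_⟧ (sym (∧-identityʳ _)))
                                                                   (count-remove (P ∘ F.suc) Pl) ⟩
  ⟦ P F.zero ∧ true ⟧ ℕ.+ suc (count ((P ∘ F.suc) ∖ l)) ≡⟨ ℕP.+-suc _ _ ⟩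
  suc (count (P ∖ F.suc l))                           ∎
  where open ≡-Reasoning

count-pos : ∀ {p} (P : Fin p → Bool) {l : Fin p} → T (P l) → 0 ℕ.< count P
count-pos P Pl = ℕP.≤-trans (s≤s z≤n) (ℕP.≤-reflexive (sym (count-remove P Pl)))

count-pos⇒∃ : ∀ {p} (P : Fin p → Bool) → 0 ℕ.< count P → ∃ (T ∘ P)
count-pos⇒∃ {suc p} P pos with P F.zero in eq
... | true = F.zero , subst T (sym eq) _
... | false = Product.map F.suc (λ t → t) (count-pos⇒∃ (P ∘ F.suc) pos)

count-empty : ∀ {p} {P : Fin p → Bool} → (∀ i → ¬ T (P i)) → count P ≡ 0
count-empty {zero} _ = refl
count-empty {suc p} {P} ¬P = cong₂ ℕ._+_ (⟦⟧-false (¬P F.zero)) (count-empty (¬P ∘ F.suc))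

count≤ : ∀ {p} (P : Fin p → Bool) → count P ℕ.≤ p
count≤ {zero} P = z≤n
count≤ {suc p} P = ℕP.+-mono-≤ (⟦⟧≤1 (P F.zero)) (count≤ (P ∘ F.suc))
  where
  ⟦⟧≤1 : ∀ x → ⟦ x ⟧ ℕ.≤ 1
  ⟦⟧≤1 false = z≤n
  ⟦⟧≤1 true = s≤s z≤n

count-strict : ∀ {p} {P Q : Fin p → Bool} {l : Fin p} → P ⊆ Q → T (Q l) → ¬ T (P l) → count P ℕ.< count Q
count-strict {P = P} {Q} {l} P⊆Q Ql ¬Pl =
  ℕP.≤-trans (s≤s (count-mono P⊆Q∖l)) (ℕP.≤-reflexive (sym (count-remove Q Ql)))
  where
  P⊆Q∖l : P ⊆ (Q ∖ l)
  P⊆Q∖l i Pi = T-∧⁺ (P⊆Q i Pi) (T-not⁺ (λ i≡l → ¬Pl (subst (T ∘ P) (==ᶠ⇒≡ i l i≡l) Pi)))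

count-last : ∀ {p} (P : Fin (suc p) → Bool) → count P ≡ ⟦ P (fromℕ p) ⟧ ℕ.+ count (P ∘ inject₁)
count-last {zero} P = refl
count-last {suc p} P =
  trans (cong (⟦ P F.zero ⟧ ℕ.+_) (count-last (P ∘ F.suc))) (ℕ-+-left-swap ⟦ P F.zero ⟧ ⟦ P (fromℕ (suc p)) ⟧ _)

count<-if-last-excluded : ∀ {p} (hp : 0 ℕ.< p) (P : Fin p → Bool) → ¬ T (P (lastIx hp)) → count P ℕ.< p
count<-if-last-excluded {suc p} _ P ¬P-last = begin-strict
  count P                                     ≡⟨ count-last P ⟩
  ⟦ P (fromℕ p) ⟧ ℕ.+ count (P ∘ inject₁)      ≡⟨ cong (ℕ._+ count (P ∘ inject₁)) (⟦⟧-false ¬P-last) ⟩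
  count (P ∘ inject₁)                         ≤⟨ count≤ (P ∘ inject₁) ⟩
  p                                           <⟨ ℕP.n<1+n p ⟩
  suc p                                       ∎
  where open ℕP.≤-Reasoning

sumWhere-cong : ∀ {p} {P Q : Fin p → Bool} (f : Fin p → ℤ) → (∀ i → P i ≡ Q i) → sumWhere P f ≡ sumWhere Q f
sumWhere-cong {zero} f P≡Q = refl
sumWhere-cong {suc p} f P≡Q =
  cong₂ _+_ (cong (λ x → if x then f F.zero else + 0) (P≡Q F.zero)) (sumWhere-cong (f ∘ F.suc) (P≡Q ∘ F.suc))

sumWhere-remove : ∀ {p} (P : Fin p → Bool) (f : Fin p → ℤ) {l : Fin p} → T (P l) →
                  sumWhere P f ≡ f l + sumWhere (P ∖ l) f
sumWhere-remove {suc p} P f {F.zero} Pl with P F.zero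
... | true = cong (λ w → f F.zero + w)
                  (trans (sumWhere-cong (f ∘ F.suc) (λ i → sym (∧-identityʳ (P (F.suc i))))) (sym (ℤP.+-identityˡ _)))
sumWhere-remove {suc p} P f {F.suc l} Pl = begin
  f₀ (P F.zero) + sumWhere (P ∘ F.suc) (f ∘ F.suc)
    ≡⟨ cong₂ _+_ (cong f₀ (sym (∧-identityʳ (P F.zero)))) (sumWhere-remove (P ∘ F.suc) (f ∘ F.suc) Pl) ⟩
  f₀ (P F.zero ∧ true) + (f (F.suc l) + sumWhere ((P ∘ F.suc) ∖ l) (f ∘ F.suc))
    ≡⟨ +-left-swap (f₀ (P F.zero ∧ true)) (f (F.suc l)) _ ⟩
  f (F.suc l) + sumWhere (P ∖ F.suc l) f ∎
  where
  open ≡-Reasoning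
  f₀ : Bool → ℤ
  f₀ x = if x then f F.zero else + 0

sumWhere-empty : ∀ {p} {P : Fin p → Bool} (f : Fin p → ℤ) → (∀ i → ¬ T (P i)) → sumWhere P f ≡ + 0
sumWhere-empty {zero} f _ = refl
sumWhere-empty {suc p} {P} f ¬P = cong₂ _+_ (ite-false (¬P F.zero)) (sumWhere-empty (f ∘ F.suc) (¬P ∘ F.suc))
  where
  ite-false : ∀ {x} → ¬ T x → (if x then f F.zero else + 0) ≡ + 0
  ite-false {false} _ = refl
  ite-false {true} ¬t = ⊥-elim (¬t _)

sumWhere-last : ∀ {p} (P : Fin (suc p) → Bool) (f : Fin (suc p) → ℤ) →
                sumWhere P f ≡ (if P (fromℕ p) then f (fromℕ p) else + 0) + sumWhere (P ∘ inject₁) (f ∘ inject₁)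
sumWhere-last {zero} P f = refl
sumWhere-last {suc p} P f = trans (cong (λ w → (if P F.zero then f F.zero else + 0) + w) (sumWhere-last (P ∘ F.suc) (f ∘ F.suc)))
                                  (+-left-swap (if P F.zero then f F.zero else + 0) (if P L then f L else + 0) _)
  where L = fromℕ (suc p)

rank : ∀ {p} → (Fin p → Bool) → Fin p → ℕ
rank Q i = count (λ i′ → Q i′ ∧ (i ≤ᶠ i′))

countBelow : ∀ {r} → (Fin r → Bool) → (Fin r → ℤ) → ℤ → ℕ
countBelow P y v = count (λ l → P l ∧ (y l <ℤᵇ v))

rank-inject₁ : ∀ {p} (Q : Fin (suc p) → Bool) (i : Fin p) →
               rank Q (inject₁ i) ≡ ⟦ Q (fromℕ p) ⟧ ℕ.+ rank (Q ∘ inject₁) i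
rank-inject₁ {p} Q i = begin
  rank Q (inject₁ i)
    ≡⟨ count-last (λ i′ → Q i′ ∧ (inject₁ i ≤ᶠ i′)) ⟩
  ⟦ Q (fromℕ p) ∧ (inject₁ i ≤ᶠ fromℕ p) ⟧ ℕ.+ count (λ i′ → Q (inject₁ i′) ∧ (inject₁ i ≤ᶠ inject₁ i′))
    ≡⟨ cong₂ ℕ._+_ (cong (λ b → ⟦ Q (fromℕ p) ∧ b ⟧) i≤last)
                   (count-cong-≡ λ i′ → cong (Q (inject₁ i′) ∧_) (cong₂ ℕ._≤ᵇ_ (FP.toℕ-inject₁ i) (FP.toℕ-inject₁ i′))) ⟩
  ⟦ Q (fromℕ p) ∧ true ⟧ ℕ.+ rank (Q ∘ inject₁) i
    ≡⟨ cong (λ b → ⟦ b ⟧ ℕ.+ rank (Q ∘ inject₁) i) (∧-identityʳ _) ⟩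
  ⟦ Q (fromℕ p) ⟧ ℕ.+ rank (Q ∘ inject₁) i ∎
  where
  open ≡-Reasoning
  i≤last : (inject₁ i ≤ᶠ fromℕ p) ≡ true
  i≤last = Equivalence.to T-≡ (≤⇒≤ᶠ (inject₁ i) (fromℕ p) (FP.≤fromℕ (inject₁ i)))

countBelow-remove : ∀ {r} (P : Fin r → Bool) (y : Fin r → ℤ) {v : ℤ} {l : Fin r} → T (P l) → y l ℤ.< v →
                    countBelow P y v ≡ suc (countBelow (P ∖ l) y v)
countBelow-remove P y {v} Pl yl<v = trans (count-remove (λ i → P i ∧ (y i <ℤᵇ v)) (T-∧⁺ Pl (<⇒<ℤᵇ yl<v)))
                                      (cong suc (count-cong-≡ λ i → ∧-right-swap (P i) _ _))

Partition-inject₁ : ∀ {p} {x : Fin (suc p) → ℤ} → Partition x → Partition (x ∘ inject₁)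
Partition-inject₁ x↓ i j i≤j =
  x↓ (inject₁ i) (inject₁ j) (subst₂ ℕ._≤_ (sym (FP.toℕ-inject₁ i)) (sym (FP.toℕ-inject₁ j)) i≤j)

-- Pair the last index L of Q with some l ∈ P below x_L and remove both.
sumWhere-dominated : ∀ {p r} (x : Fin p → ℤ) (Q : Fin p → Bool) (y : Fin r → ℤ) (P : Fin r → Bool) →
  Partition x → count P ℕ.≤ count Q → (∀ i → T (Q i) → rank Q i ℕ.≤ countBelow P y (x i)) →
  sumWhere P y ℤ.≤ sumWhere Q x × (0 ℕ.< count Q → sumWhere P y ℤ.< sumWhere Q x)
sumWhere-dominated {zero} x Q y P _ P≤Q _ = ℤP.≤-reflexive (sumWhere-empty y P-empty) , λ ()
  where
  P-empty : ∀ l → ¬ T (P l)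
  P-empty l Pl = ℕP.≤⇒≯ P≤Q (count-pos P Pl)
sumWhere-dominated {suc p} x Q y P x↓ P≤Q rank≤
  with Q (fromℕ p) in QL | count-last Q | sumWhere-last Q x | rank-inject₁ Q
... | false | countQ | sumQ | rank≡ = subst (sumWhere P y ℤ.≤_) (sym sumQ′) (proj₁ IH)
                                    , λ pos → subst (sumWhere P y ℤ.<_) (sym sumQ′) (proj₂ IH (subst (0 ℕ.<_) countQ pos))
  where
  sumQ′ : sumWhere Q x ≡ sumWhere (Q ∘ inject₁) (x ∘ inject₁)
  sumQ′ = trans sumQ (ℤP.+-identityˡ _)
  IH = sumWhere-dominated (x ∘ inject₁) (Q ∘ inject₁) y P (Partition-inject₁ x↓) (subst (count P ℕ.≤_) countQ P≤Q)
                          (λ i Qi → subst (ℕ._≤ _) (rank≡ i) (rank≤ (inject₁ i) Qi))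
... | true | countQ | sumQ | rank≡ = ℤP.<⇒≤ strict , λ _ → strict
  where
  L = fromℕ p
  QL′ : T (Q L)
  QL′ = subst T (sym QL) _
  witness : ∃ λ l → T (P l ∧ (y l <ℤᵇ x L))
  witness = count-pos⇒∃ (λ l → P l ∧ (y l <ℤᵇ x L))
                        (ℕP.<-≤-trans (count-pos (λ i → Q i ∧ (L ≤ᶠ i)) (T-∧⁺ QL′ (≤⇒≤ᶠ L L ℕP.≤-refl)))
                                      (rank≤ L QL′))
  l = proj₁ witness
  Pl : T (P l)
  Pl = proj₁ (T-∧⁻ (proj₂ witness))
  yl<xL : y l ℤ.< x L
  yl<xL = <ℤᵇ⇒< (proj₂ (T-∧⁻ (proj₂ witness)))
  below≡ : ∀ i → countBelow P y (x (inject₁ i)) ≡ suc (countBelow (P ∖ l) y (x (inject₁ i)))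
  below≡ i = countBelow-remove P y Pl (ℤP.<-≤-trans yl<xL (x↓ (inject₁ i) L (FP.≤fromℕ (inject₁ i))))
  IH = sumWhere-dominated (x ∘ inject₁) (Q ∘ inject₁) y (P ∖ l) (Partition-inject₁ x↓)
         (ℕ.s≤s⁻¹ (subst₂ ℕ._≤_ (count-remove P Pl) countQ P≤Q))
         (λ i Qi → ℕ.s≤s⁻¹ (subst₂ ℕ._≤_ (rank≡ i) (below≡ i) (rank≤ (inject₁ i) Qi)))
  strict : sumWhere P y ℤ.< sumWhere Q x
  strict = subst₂ ℤ._<_ (sym (sumWhere-remove P y Pl)) (sym sumQ) (ℤP.+-mono-<-≤ yl<xL (proj₁ IH))

-- The arithmetic of q_j and N

+-minus-cancel : ∀ x k → x + k - k ≡ x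
+-minus-cancel x k = trans (ℤP.+-assoc x k (- k)) (trans (cong (λ w → x + w) (ℤP.+-inverseʳ k)) (ℤP.+-identityʳ x))

+-cancelʳ-≤ : ∀ {i j} k → i + k ℤ.≤ j + k → i ℤ.≤ j
+-cancelʳ-≤ {i} {j} k i+k≤j+k = subst₂ ℤ._≤_ (+-minus-cancel i k) (+-minus-cancel j k) (ℤP.+-monoˡ-≤ (- k) i+k≤j+k)

+-cancelʳ-< : ∀ {i j} k → i + k ℤ.< j + k → i ℤ.< j
+-cancelʳ-< {i} {j} k i+k<j+k = subst₂ ℤ._<_ (+-minus-cancel i k) (+-minus-cancel j k) (ℤP.+-monoˡ-< (- k) i+k<j+k)

qValue : ℕ → ℕ → ℕ → ℤ
qValue t A B = + t - + A + + B + + 1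

qValue+A : ∀ t A B → qValue t A B + + A ≡ + t + + (suc B)
qValue+A t A B = rearrange (+ t) (+ A) (+ B)
  where
  rearrange : ∀ t a b → t - a + b + + 1 + a ≡ t + (+ 1 + b)
  rearrange = solve-∀

qValue≤⇒< : ∀ t A B → qValue t A B ℤ.≤ + t → B ℕ.< A
qValue≤⇒< t A B q≤t =
  ℕP.+-cancelˡ-≤ t _ _ (ℤP.drop‿+≤+ (subst (ℤ._≤ + t + + A) (qValue+A t A B) (ℤP.+-monoˡ-≤ (+ A) q≤t)))

<⇒qValue≤ : ∀ t A B → B ℕ.< A → qValue t A B ℤ.≤ + t
<⇒qValue≤ t A B B<A =
  +-cancelʳ-≤ (+ A) (subst (ℤ._≤ + t + + A) (sym (qValue+A t A B)) (ℤ.+≤+ (ℕP.+-monoʳ-≤ t B<A)))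

<⇒qValue< : ∀ t A B → suc B ℕ.< A → qValue t A B ℤ.< + t
<⇒qValue< t A B 1+B<A =
  +-cancelʳ-< (+ A) (subst (ℤ._< + t + + A) (sym (qValue+A t A B)) (ℤ.+<+ (ℕP.+-monoʳ-< t 1+B<A)))

qValue-suc : ∀ t B → qValue t (suc B) B ≡ + t
qValue-suc t B = cancel (+ t) (+ B)
  where
  cancel : ∀ t b → t - (+ 1 + b) + b + + 1 ≡ t
  cancel = solve-∀

N-bound : ∀ {α t β γ W} → α ℕ.< t → β ℕ.≤ W ℕ.+ γ → + α - + t + + β - + γ + + 1 ℤ.≤ + W
N-bound {α} {t} {β} {γ} {W} α<t β≤W+γ =
  +-cancelʳ-≤ (+ t + + γ) (subst₂ ℤ._≤_ (lhs (+ α) (+ t) (+ β) (+ γ)) (rhs (+ t) (+ W) (+ γ))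
                                        (ℤP.+-mono-≤ (ℤ.+≤+ α<t) (ℤ.+≤+ β≤W+γ)))
  where
  lhs : ∀ a t b g → + 1 + a + b ≡ a - t + b - g + + 1 + (t + g)
  lhs = solve-∀
  rhs : ∀ t w g → t + (w + g) ≡ w + (t + g)
  rhs = solve-∀

-- Lists, and the sequence e

head-filterᵇ : ∀ {A : Set} (P : A → Bool) xs {l} → head (filterᵇ P xs) ≡ just l → T (P l)
head-filterᵇ P (x ∷ xs) first with P x in Px
... | true = subst (T ∘ P) (just-injective first) (subst T (sym Px) _)
... | false = head-filterᵇ P xs first

lastN-split : ∀ {A : Set} (P : A → Bool) K (L : List A) → T (any P (lastN K L)) →
              ∃ λ pre → ∃ λ e → ∃ λ post → (L ≡ pre ++ e ∷ post) × T (P e) × length post ℕ.< K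
lastN-split P K L t with find (AnyP.any⁻ P (lastN K L) t)
... | e , e∈ , Pe with ∈-∃++ e∈
... | ys , zs , drop≡ = take n L ++ ys , e , zs , L≡ , Pe , zs<K
  where
  n = length L ∸ K
  L≡ : L ≡ (take n L ++ ys) ++ e ∷ zs
  L≡ = trans (sym (LP.take++drop≡id n L)) (trans (cong (take n L ++_) drop≡) (sym (LP.++-assoc (take n L) ys (e ∷ zs))))
  zs<K : length zs ℕ.< K
  zs<K = begin-strict
    length zs                     <⟨ ℕP.n<1+n _ ⟩
    suc (length zs)               ≤⟨ ℕP.m≤n+m _ (length ys) ⟩
    length ys ℕ.+ length (e ∷ zs) ≡⟨ sym (LP.length-++ ys) ⟩
    length (ys ++ e ∷ zs)         ≡⟨ cong length (sym drop≡) ⟩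
    length (drop n L)             ≡⟨ LP.length-drop n L ⟩
    length L ∸ n                  ≤⟨ ℕP.m≤n+o⇒m∸n≤o (length L) n
                                                    (subst (length L ℕ.≤_) (ℕP.+-comm K n) (ℕP.m≤n+m∸n (length L) K)) ⟩
    K                             ∎
    where open ℕP.≤-Reasoning

mapMaybe-isInj₂-mergeDesc : ∀ {t p} (z : Fin t → ℤ) (x : Fin p → ℤ) us vs → mapMaybe isInj₂ (mergeDesc z x us vs) ≡ vs
mapMaybe-isInj₂-mergeDesc z x [] vs = trans (LP.mapMaybe-map isInj₂ inj₂ vs) (LP.mapMaybe-just vs)
mapMaybe-isInj₂-mergeDesc z x (u ∷ us) = go
  where
  go : ∀ vs → mapMaybe isInj₂ (mergeDesc z x (u ∷ us) vs) ≡ vs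
  go [] = trans (LP.mapMaybe-map isInj₂ inj₁ (u ∷ us)) (LP.mapMaybe-nothing (u ∷ us))
  go (v ∷ vs) with x v ≤ᵇ z u
  ... | true = mapMaybe-isInj₂-mergeDesc z x us (v ∷ vs)
  ... | false = cong (v ∷_) (go vs)

mapMaybe-isInj₂-filterᵇ : ∀ {A B : Set} (G : A ⊎ B → Bool) xs →
                          mapMaybe isInj₂ (filterᵇ G xs) ≡ filterᵇ (G ∘ inj₂) (mapMaybe isInj₂ xs)
mapMaybe-isInj₂-filterᵇ G [] = refl
mapMaybe-isInj₂-filterᵇ G (inj₁ a ∷ xs) with G (inj₁ a)
... | true = mapMaybe-isInj₂-filterᵇ G xs
... | false = mapMaybe-isInj₂-filterᵇ G xs
mapMaybe-isInj₂-filterᵇ G (inj₂ b ∷ xs) with G (inj₂ b)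
... | true = cong (b ∷_) (mapMaybe-isInj₂-filterᵇ G xs)
... | false = mapMaybe-isInj₂-filterᵇ G xs

filterᵇ-∧ : ∀ {A : Set} (H G : A → Bool) xs → filterᵇ (λ a → H a ∧ G a) xs ≡ filterᵇ H (filterᵇ G xs)
filterᵇ-∧ H G [] = refl
filterᵇ-∧ H G (a ∷ xs) with G a
... | false with H a
...   | true = filterᵇ-∧ H G xs
...   | false = filterᵇ-∧ H G xs
filterᵇ-∧ H G (a ∷ xs) | true with H a
...   | true = cong (a ∷_) (filterᵇ-∧ H G xs)
...   | false = filterᵇ-∧ H G xs

length-filter-after : ∀ {p} (j : Fin p) W₁ W₂ → AllPairs F._<_ (W₁ ++ j ∷ W₂) →
                      length (filterᵇ (j <ᶠ_) (W₁ ++ j ∷ W₂)) ℕ.≤ length W₂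
length-filter-after j [] W₂ _ with j <ᶠ j in eq
... | true = ⊥-elim (ℕP.<-irrefl refl (<ᶠ⇒< j j (subst T (sym eq) _)))
... | false = LP.length-filter _ W₂
length-filter-after j (w ∷ W₁) W₂ (w<W ∷ sorted) with j <ᶠ w in eq
... | true = ⊥-elim (ℕP.<-asym (<ᶠ⇒< j w (subst T (sym eq) _)) (All.head (AllP.++⁻ʳ W₁ w<W)))
... | false = length-filter-after j W₁ W₂ sorted

-- The own entries of e appear in index order, so each i > j above the cut comes after x_j.
own-in-lastN⇒later-count< : ∀ {t p} (z : Fin t → ℤ) (x : Fin p → ℤ) (G : Fin t ⊎ Fin p → Bool) (j : Fin p) K →
                T (any (isOwn j) (lastN K (filterᵇ G (eSeq z x)))) →
                suc (count (λ i → (j <ᶠ i) ∧ G (inj₂ i))) ℕ.≤ K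
own-in-lastN⇒later-count< {t} {p} z x G j K own with lastN-split (isOwn j) K _ own
... | pre , inj₂ j′ , post , L≡ , j′≡j , post<K with ==ᶠ⇒≡ j′ j j′≡j
... | refl = ℕP.≤-trans (s≤s after≤post) post<K
  where
  W≡ : filterᵇ (G ∘ inj₂) (allFin p) ≡ mapMaybe isInj₂ pre ++ j ∷ mapMaybe isInj₂ post
  W≡ = begin
    filterᵇ (G ∘ inj₂) (allFin p)
      ≡⟨ cong (filterᵇ (G ∘ inj₂)) (sym (mapMaybe-isInj₂-mergeDesc z x (allFin t) (allFin p))) ⟩
    filterᵇ (G ∘ inj₂) (mapMaybe isInj₂ (eSeq z x))
      ≡⟨ sym (mapMaybe-isInj₂-filterᵇ G (eSeq z x)) ⟩
    mapMaybe isInj₂ (filterᵇ G (eSeq z x))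
      ≡⟨ cong (mapMaybe isInj₂) L≡ ⟩
    mapMaybe isInj₂ (pre ++ inj₂ j ∷ post)
      ≡⟨ LP.mapMaybe-++ isInj₂ pre (inj₂ j ∷ post) ⟩
    mapMaybe isInj₂ pre ++ j ∷ mapMaybe isInj₂ post ∎
    where open ≡-Reasoning
  sorted : AllPairs F._<_ (filterᵇ (G ∘ inj₂) (allFin p))
  sorted = AllPairsP.filter⁺ _ (AllPairsP.tabulate⁺-< (λ i<j → i<j))
  after≤post : count (λ i → (j <ᶠ i) ∧ G (inj₂ i)) ℕ.≤ length post
  after≤post = begin
    count (λ i → (j <ᶠ i) ∧ G (inj₂ i))
      ≡⟨ sym (cnt≡count (λ i → (j <ᶠ i) ∧ G (inj₂ i))) ⟩
    length (filterᵇ (λ i → (j <ᶠ i) ∧ G (inj₂ i)) (allFin p))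
      ≡⟨ cong length (filterᵇ-∧ (j <ᶠ_) (G ∘ inj₂) (allFin p)) ⟩
    length (filterᵇ (j <ᶠ_) (filterᵇ (G ∘ inj₂) (allFin p)))
      ≡⟨ cong (length ∘ filterᵇ (j <ᶠ_)) W≡ ⟩
    length (filterᵇ (j <ᶠ_) (mapMaybe isInj₂ pre ++ j ∷ mapMaybe isInj₂ post))
      ≤⟨ length-filter-after j (mapMaybe isInj₂ pre) (mapMaybe isInj₂ post) (subst (AllPairs F._<_) W≡ sorted) ⟩
    length (mapMaybe isInj₂ post)
      ≤⟨ LP.length-mapMaybe isInj₂ post ⟩
    length post ∎
    where open ℕP.≤-Reasoning

All-reverse⁺ : ∀ {A : Set} {P : A → Set} {xs : List A} → All P xs → All P (reverse xs)
All-reverse⁺ {xs = []} [] = []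
All-reverse⁺ {P = P} {x ∷ xs} (px ∷ pxs) =
  subst (All P) (sym (LP.unfold-reverse x xs)) (AllP.++⁺ (All-reverse⁺ pxs) (px ∷ []))

AllPairs-reverse⁺ : ∀ {A : Set} {R : A → A → Set} {xs : List A} → AllPairs (flip R) xs → AllPairs R (reverse xs)
AllPairs-reverse⁺ {xs = []} [] = []
AllPairs-reverse⁺ {R = R} {x ∷ xs} (px ∷ pxs) =
  subst (AllPairs R) (sym (LP.unfold-reverse x xs))
        (AllPairsP.++⁺ (AllPairs-reverse⁺ pxs) ([] ∷ []) (All.map (_∷ []) (All-reverse⁺ px)))

last-map-sorted : ∀ {n} (c : Fin n → ℤ) xs {γ} → AllPairs F._<_ xs → last (map c xs) ≡ just γ →
                  ∃ λ l → l ∈ xs × c l ≡ γ × All (F._≤ l) xs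
last-map-sorted c (x ∷ []) _ refl = x , here refl , refl , ℕP.≤-refl ∷ []
last-map-sorted c (x ∷ y ∷ ys) (x<ys ∷ sorted) last≡ with last-map-sorted c (y ∷ ys) sorted last≡
... | l , l∈ , cl≡γ , ys≤l = l , there l∈ , cl≡γ , ℕP.<⇒≤ (All.lookup x<ys l∈) ∷ ys≤l

cLast-spec : ∀ {n} {c : Fin n → ℤ} {S : Fin n → Bool} {γ : ℤ} → Partition c → cLast c S ≡ just γ →
             ∃ λ l₀ → T (S l₀) × c l₀ ≡ γ × (∀ l → T (S l) → γ ℤ.≤ c l)
cLast-spec {n} {c} {S} c↓ last≡ with last-map-sorted c (filterᵇ S (allFin n)) sorted last≡
  where
  sorted : AllPairs F._<_ (filterᵇ S (allFin n))
  sorted = AllPairsP.filter⁺ _ (AllPairsP.tabulate⁺-< (λ i<j → i<j))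
... | l₀ , l₀∈ , cl₀≡γ , S≤l₀ =
  l₀ , proj₂ (∈-filter⁻ (T? ∘ S) {xs = allFin n} l₀∈) , cl₀≡γ ,
  λ l Sl → subst (ℤ._≤ c l) cl₀≡γ (c↓ l l₀ (All.lookup S≤l₀ (∈-filter⁺ (T? ∘ S) (∈-allFin l) Sl)))

-- The construction

module ProcessingOrder {n m : ℕ} (c : Fin n → ℤ) (d : Fin m → ℤ) where

  -- x ⋖ y: the entry x is processed before y.
  _⋖_ : Fin n ⊎ Fin m → Fin n ⊎ Fin m → Set
  inj₁ i ⋖ inj₁ i′ = i′ F.< i
  inj₁ i ⋖ inj₂ j  = c i ℤ.< d j
  inj₂ j ⋖ inj₁ i  = d j ℤ.< c i
  inj₂ j ⋖ inj₂ j′ = j′ F.< j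

  ⋖-irrefl : ∀ x → ¬ x ⋖ x
  ⋖-irrefl (inj₁ i) = ℕP.<-irrefl refl
  ⋖-irrefl (inj₂ j) = ℕP.<-irrefl refl

  mergeAsc-All : ∀ {P : Fin n ⊎ Fin m → Set} us vs → All (P ∘ inj₁) us → All (P ∘ inj₂) vs →
                 All P (mergeAsc c d us vs)
  mergeAsc-All [] vs _ Pvs = AllP.map⁺ Pvs
  mergeAsc-All {P} (u ∷ us) vs (Pu ∷ Pus) = go vs
    where
    go : ∀ vs → All (P ∘ inj₂) vs → All P (mergeAsc c d (u ∷ us) vs)
    go [] _ = AllP.map⁺ (Pu ∷ Pus)
    go (v ∷ vs) (Pv ∷ Pvs) with c u ≤ᵇ d v
    ... | true = Pu ∷ mergeAsc-All us (v ∷ vs) Pus (Pv ∷ Pvs)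
    ... | false = Pv ∷ go vs Pvs

  inj₂∈mergeAsc : ∀ us vs {v} → v ∈ vs → inj₂ v ∈ mergeAsc c d us vs
  inj₂∈mergeAsc [] vs v∈ = AnyP.map⁺ (Any.map (cong inj₂) v∈)
  inj₂∈mergeAsc (u ∷ us) (v ∷ vs) v∈ with c u ≤ᵇ d v
  ... | true = there (inj₂∈mergeAsc us (v ∷ vs) v∈)
  inj₂∈mergeAsc (u ∷ us) (v ∷ vs) (here refl) | false = here refl
  inj₂∈mergeAsc (u ∷ us) (v ∷ vs) (there v∈) | false = there (inj₂∈mergeAsc (u ∷ us) vs v∈)

  inj₂∈order : ∀ j → inj₂ j ∈ order c d
  inj₂∈order j = inj₂∈mergeAsc (reverse (allFin n)) (reverse (allFin m)) (AnyP.reverse⁺ (∈-allFin j))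

  module _ (c↓ : Partition c) (d↓ : Partition d) (c≢d : ∀ i j → c i ≢ d j) where

    mergeAsc-sorted : ∀ us vs → AllPairs F._>_ us → AllPairs F._>_ vs → AllPairs _⋖_ (mergeAsc c d us vs)
    mergeAsc-sorted [] vs _ vs↓ = AllPairsP.map⁺ vs↓
    mergeAsc-sorted (u ∷ us) vs (u>us ∷ us↓) = go vs
      where
      go : ∀ vs → AllPairs F._>_ vs → AllPairs _⋖_ (mergeAsc c d (u ∷ us) vs)
      go [] _ = AllPairsP.map⁺ (u>us ∷ us↓)
      go (v ∷ vs) (v>vs ∷ vs↓) with c u ≤ᵇ d v in cu≤dv
      ... | true = mergeAsc-All us (v ∷ vs) u>us (cu<dv ∷ All.map cu<d v>vs) ∷ mergeAsc-sorted us (v ∷ vs) us↓ (v>vs ∷ vs↓)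
        where
        cu<dv : c u ℤ.< d v
        cu<dv = ℤP.≤∧≢⇒< (ℤP.≤ᵇ⇒≤ (subst T (sym cu≤dv) _)) (c≢d u v)
        cu<d : ∀ {v′} → v′ F.< v → c u ℤ.< d v′
        cu<d {v′} v′<v = ℤP.≤∧≢⇒< (ℤP.≤-trans (ℤP.<⇒≤ cu<dv) (d↓ v′ v (ℕP.<⇒≤ v′<v))) (c≢d u v′)
      ... | false = mergeAsc-All (u ∷ us) vs (dv<cu ∷ All.map dv<c u>us) v>vs ∷ go vs vs↓
        where
        dv<cu : d v ℤ.< c u
        dv<cu = ℤP.≰⇒> (λ cu≤dv′ → subst T cu≤dv (ℤP.≤⇒≤ᵇ cu≤dv′))
        dv<c : ∀ {u′} → u′ F.< u → d v ℤ.< c u′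
        dv<c {u′} u′<u = ℤP.<-≤-trans dv<cu (c↓ u′ u (ℕP.<⇒≤ u′<u))

    order-sorted : AllPairs _⋖_ (order c d)
    order-sorted = mergeAsc-sorted (reverse (allFin n)) (reverse (allFin m)) allFin-reverse-sorted allFin-reverse-sorted
      where
      allFin-reverse-sorted : ∀ {p} → AllPairs F._>_ (reverse (allFin p))
      allFin-reverse-sorted = AllPairs-reverse⁺ (AllPairsP.tabulate⁺-< (λ i<j → i<j))

module LocalUpdates {K State : Set} (V : K → Set) (view : (y : K) → State → V y)
                    (step : State → K → State)
                    (step-local : ∀ σ {y z} → y ≢ z → view y (step σ z) ≡ view y σ) where

  foldl-untouched : ∀ y L σ → All (y ≢_) L → view y (foldl step σ L) ≡ view y σ
  foldl-untouched y [] σ [] = refl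
  foldl-untouched y (z ∷ L) σ (y≢z ∷ y∉L) = trans (foldl-untouched y L (step σ z) y∉L) (step-local σ y≢z)

  foldl-snapshot : ∀ {_≺_ : K → K → Set} → (∀ x → ¬ x ≺ x) → ∀ L σ₀ {x} → AllPairs _≺_ L → x ∈ L →
                   ∃ λ σ → view x (foldl step σ₀ L) ≡ view x (step σ x)
                         × (∀ y → y ≢ x → ¬ x ≺ y → view y (foldl step σ₀ L) ≡ view y σ)
  foldl-snapshot {_≺_} ≺-irrefl (x ∷ L) σ₀ (x≺L ∷ _) (here refl) =
    σ₀ , foldl-untouched x L (step σ₀ x) (unrelated⇒∉ (≺-irrefl x))
       , λ y y≢x x⊀y → trans (foldl-untouched y L (step σ₀ x) (unrelated⇒∉ x⊀y)) (step-local σ₀ y≢x)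
    where
    unrelated⇒∉ : ∀ {y} → ¬ x ≺ y → All (y ≢_) L
    unrelated⇒∉ x⊀y = All.map (λ x≺w y≡w → x⊀y (subst (x ≺_) (sym y≡w) x≺w)) x≺L
  foldl-snapshot ≺-irrefl (z ∷ L) σ₀ (_ ∷ L-sorted) (there x∈L) = foldl-snapshot ≺-irrefl L (step σ₀ z) L-sorted x∈L

-- The local definitions of decide in Defs, which are not exported.
module Decision {p r t : ℕ} (x : Fin p → ℤ) (y : Fin r → ℤ) (z : Fin t → ℤ)
                (X : Fin p → Bool) (Y : Fin r → Bool) (j : Fin p) where

  below : Fin r → Bool
  below i = Y i ∧ (y i <ℤᵇ x j)

  after : Fin p → Bool
  after i = (j <ᶠ i) ∧ not (X i)

  q : ℤ
  q = qValue t (cnt below) (cnt after)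

  N : Fin r → ℤ
  N l = + cnt (λ i → y l <ℤᵇ z i) - + t
        + + cnt (λ i → Y i ∧ (l <ᶠ i))
        - + cnt (λ i → not (X i) ∧ (x i <ℤᵇ y l)) + + 1

  condA : Fin r → Bool
  condA l = (+ 1 ≤ᵇ N l) ∧
            any (isOwn j) (lastN ∣ N l ∣ (filterᵇ (λ e → y l <ℤᵇ eVal z x e) (eSeq z x)))

  data Exclusion : Set where
    by-rule-a : ∀ l → T (below l) → T (condA l) → Exclusion
    by-rule-b : ∀ w → tailSum z q ≡ just w → sumOver after x + x j + w ℤ.≤ sumOver below y → Exclusion

  condA⇒N-large : ∀ l → T (condA l) → + suc (count (λ i → (j <ᶠ i) ∧ (y l <ℤᵇ x i))) ℤ.≤ N l
  condA⇒N-large l ruleA =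
    subst (+ suc W ℤ.≤_) (ℤP.0≤i⇒+∣i∣≡i (ℤP.≤-trans (ℤ.+≤+ z≤n) 1≤N)) (ℤ.+≤+ W<∣N∣)
    where
    W = count (λ i → (j <ᶠ i) ∧ (y l <ℤᵇ x i))
    1≤N : + 1 ℤ.≤ N l
    1≤N = ℤP.≤ᵇ⇒≤ (proj₁ (T-∧⁻ {+ 1 ≤ᵇ N l} ruleA))
    W<∣N∣ : W ℕ.< ∣ N l ∣
    W<∣N∣ = own-in-lastN⇒later-count< z x (λ e → y l <ℤᵇ eVal z x e) j ∣ N l ∣
                                       (proj₂ (T-∧⁻ {+ 1 ≤ᵇ N l} ruleA))

  excluded⇒q≤t : proj₂ (decide x y z X Y j) ≡ false → q ℤ.≤ + t
  excluded⇒q≤t excluded with (+ t) <ℤᵇ q in t<q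
  ... | false = ℤP.≮⇒≥ (λ t<q′ → subst T t<q (<⇒<ℤᵇ t<q′))

  excluded⇒exclusion : proj₂ (decide x y z X Y j) ≡ false → Exclusion
  excluded⇒exclusion excluded with (+ t) <ℤᵇ q | head (filterᵇ below (allFin r)) in first
  ... | false | just l with condA l in ruleA
  ...   | true = by-rule-a l (head-filterᵇ below (allFin r) first) (subst T (sym ruleA) _)
  ...   | false with tailSum z q in tail
  ...     | just w = by-rule-b w tail (ℤP.≤ᵇ⇒≤ (Equivalence.from T-≡ (not-injective excluded)))

module Construction {m n s k : ℕ} (a : Fin s → ℤ) (d : Fin m → ℤ) (b : Fin k → ℤ) (c : Fin n → ℤ)
                    (c↓ : Partition c) (d↓ : Partition d) (c≢d : ∀ i j → c i ≢ d j) where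

  open ProcessingOrder c d

  S : Fin n → Bool
  S = State.S (construction a d b c)

  Δ : Fin m → Bool
  Δ = State.Δ (construction a d b c)

  qd : Fin m → ℤ
  qd = State.qd (construction a d b c)

  Entry : Fin n ⊎ Fin m → Set
  Entry (inj₁ _) = Bool
  Entry (inj₂ _) = Bool × ℤ

  entry : (y : Fin n ⊎ Fin m) → State n m → Entry y
  entry (inj₁ i) σ = State.S σ i
  entry (inj₂ j) σ = State.Δ σ j , State.qd σ j

  step-local : ∀ σ {y z} → y ≢ z → entry y (step a d b c σ z) ≡ entry y σ
  step-local (st S Δ qd) {inj₁ i} {inj₁ i′} i≢i′ = upd-other S i′ _ (i≢i′ ∘ cong inj₁)
  step-local (st S Δ qd) {inj₁ i} {inj₂ j′} _ = refl
  step-local (st S Δ qd) {inj₂ j} {inj₁ i′} _ = refl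
  step-local (st S Δ qd) {inj₂ j} {inj₂ j′} j≢j′ =
    cong₂ _,_ (upd-other Δ j′ _ (j≢j′ ∘ cong inj₂)) (upd-other qd j′ _ (j≢j′ ∘ cong inj₂))

  open LocalUpdates Entry entry (step a d b c) step-local

  -- σ is the state just before d_j is processed.
  record Snapshot (j : Fin m) : Set where
    field
      σ : State n m
      Δ-decided : Δ j ≡ proj₂ (decide d c a (State.Δ σ) (State.S σ) j)
      qd-decided : qd j ≡ proj₁ (decide d c a (State.Δ σ) (State.S σ) j)
      S-settled : ∀ i → c i ℤ.< d j → State.S σ i ≡ S i
      Δ-settled : ∀ i → j F.< i → State.Δ σ i ≡ Δ i

  snapshot : ∀ j → Snapshot j
  snapshot j with foldl-snapshot ⋖-irrefl (order c d) (st (λ _ → false) (λ _ → false) (λ _ → + 0))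
                                 (order-sorted c↓ d↓ c≢d) (inj₂∈order j)
  ... | σ , at-j , elsewhere = record
    { σ = σ
    ; Δ-decided = trans (cong proj₁ at-j) (upd-same (State.Δ σ) j _)
    ; qd-decided = trans (cong proj₂ at-j) (upd-same (State.qd σ) j _)
    ; S-settled = λ i ci<dj → sym (elsewhere (inj₁ i) (λ ()) (ℤP.<-asym ci<dj))
    ; Δ-settled = λ i j<i → sym (cong proj₁ (elsewhere (inj₂ i) (λ { refl → ℕP.<-irrefl refl j<i }) (ℕP.<-asym j<i)))
    }

  Below : Fin m → Fin n → Bool
  Below j l = S l ∧ (c l <ℤᵇ d j)

  After : Fin m → Fin m → Bool
  After j i = (j <ᶠ i) ∧ not (Δ i)

  From : Fin m → Fin m → Bool
  From j i = not (Δ i) ∧ (j ≤ᶠ i)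

  #below #after #from : Fin m → ℕ
  #below j = count (Below j)
  #after j = count (After j)
  #from j = count (From j)

  module At (j : Fin m) where
    open Snapshot (snapshot j) public
    open Decision d c a (State.Δ σ) (State.S σ) j public

    below≡ : ∀ l → below l ≡ Below j l
    below≡ l = ∧-congˡ (λ cl<dj → S-settled l (<ℤᵇ⇒< cl<dj))

    after≡ : ∀ i → after i ≡ After j i
    after≡ i = ∧-congʳ (λ j<i → cong not (Δ-settled i (<ᶠ⇒< j i j<i)))

    cnt-below : cnt below ≡ #below j
    cnt-below = trans (cnt≡count below) (count-cong-≡ below≡)

    cnt-after : cnt after ≡ #after j
    cnt-after = trans (cnt≡count after) (count-cong-≡ after≡)

    q≡ : q ≡ qValue s (#below j) (#after j)
    q≡ = cong₂ (qValue s) cnt-below cnt-after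

  qd≡ : ∀ j → qd j ≡ qValue s (#below j) (#after j)
  qd≡ j = trans qd-decided q≡
    where open At j

  excluded⇒after<below : ∀ j → Δ j ≡ false → #after j ℕ.< #below j
  excluded⇒after<below j j∉Δ = qValue≤⇒< s _ _ (subst (ℤ._≤ + s) q≡ (excluded⇒q≤t (trans (sym Δ-decided) j∉Δ)))
    where open At j

  After⊆From : ∀ j → After j ⊆ From j
  After⊆From j i j<i∉Δ = let j<i , i∉Δ = T-∧⁻ {j <ᶠ i} j<i∉Δ in
    T-∧⁺ i∉Δ (≤⇒≤ᶠ j i (ℕP.<⇒≤ (<ᶠ⇒< j i j<i)))

  From∖j⊆After : ∀ j → (From j ∖ j) ⊆ After j
  From∖j⊆After j i t = T-∧⁺ (<⇒<ᶠ j i (ℕP.≤∧≢⇒< (≤ᶠ⇒≤ j i j≤i) j≢i)) i∉Δ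
    where
    i∈From = proj₁ (T-∧⁻ {From j i} t)
    i∉Δ = proj₁ (T-∧⁻ {not (Δ i)} i∈From)
    j≤i = proj₂ (T-∧⁻ {not (Δ i)} i∈From)
    j≢i : toℕ j ≢ toℕ i
    j≢i j≡i = T-not⁻ (proj₂ (T-∧⁻ {From j i} t)) (subst (λ w → T (w ==ᶠ j)) (FP.toℕ-injective j≡i) (==ᶠ-refl j))

  After⊆From∖j : ∀ j → After j ⊆ (From j ∖ j)
  After⊆From∖j j i t = let j<i , _ = T-∧⁻ {j <ᶠ i} t in
    T-∧⁺ (After⊆From j i t) (T-not⁺ (λ i≡j → ℕP.<-irrefl (cong toℕ (sym (==ᶠ⇒≡ i j i≡j))) (<ᶠ⇒< j i j<i)))

  j∈From : ∀ j → Δ j ≡ false → T (From j j)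
  j∈From j j∉Δ = T-∧⁺ (subst (T ∘ not) (sym j∉Δ) _) (≤⇒≤ᶠ j j ℕP.≤-refl)

  #from-∉Δ : ∀ j → Δ j ≡ false → #from j ≡ suc (#after j)
  #from-∉Δ j j∉Δ = trans (count-remove (From j) (j∈From j j∉Δ))
                         (cong suc (count-cong (From∖j⊆After j) (After⊆From∖j j)))

  #from-∈Δ : ∀ j → Δ j ≡ true → #from j ≡ #after j
  #from-∈Δ j j∈Δ = count-cong From⊆After (After⊆From j)
    where
    From⊆After : From j ⊆ After j
    From⊆After i t = From∖j⊆After j i (T-∧⁺ t (T-not⁺ (λ i≡j → T-not⁻ (proj₁ (T-∧⁻ {not (Δ i)} t))
                                                    (subst (T ∘ Δ) (sym (==ᶠ⇒≡ i j i≡j)) (subst T (sym j∈Δ) _)))))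

  #after-last : ∀ j → suc (toℕ j) ≡ m → #after j ≡ 0
  #after-last j j-last =
    count-empty (λ i t → ℕP.<⇒≱ (FP.toℕ<n i) (subst (ℕ._≤ toℕ i) j-last (<ᶠ⇒< j i (proj₁ (T-∧⁻ {j <ᶠ i} t)))))

  #after-next : ∀ j j′ → toℕ j′ ≡ suc (toℕ j) → #after j ≡ #from j′
  #after-next j j′ j′≡ = count-cong
    (λ i t → let j<i , i∉Δ = T-∧⁻ {j <ᶠ i} t in
             T-∧⁺ i∉Δ (≤⇒≤ᶠ j′ i (subst (ℕ._≤ toℕ i) (sym j′≡) (<ᶠ⇒< j i j<i))))
    (λ i t → let i∉Δ , j′≤i = T-∧⁻ {not (Δ i)} t in
             T-∧⁺ (<⇒<ᶠ j i (subst (ℕ._≤ toℕ i) j′≡ (≤ᶠ⇒≤ j′ i j′≤i))) i∉Δ)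

  Below-mono : ∀ {i j} → d i ℤ.≤ d j → Below i ⊆ Below j
  Below-mono di≤dj l t = let Sl , cl<di = T-∧⁻ {S l} t in T-∧⁺ Sl (<⇒<ℤᵇ (ℤP.<-≤-trans (<ℤᵇ⇒< cl<di) di≤dj))

  #below-mono : ∀ {i j} → d i ℤ.≤ d j → #below i ℕ.≤ #below j
  #below-mono di≤dj = count-mono (Below-mono di≤dj)

  #from≤#below : ∀ i → #from i ℕ.≤ #below i ⊎ #from i ≡ 0
  #from≤#below = Fin-downward-induction _ induction-step
    where
    induction-step : ∀ i → (∀ i′ → toℕ i′ ≡ suc (toℕ i) → #from i′ ℕ.≤ #below i′ ⊎ #from i′ ≡ 0) →
                     #from i ℕ.≤ #below i ⊎ #from i ≡ 0
    induction-step i IH with Δ i in Δi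
    ... | false = inj₁ (subst (ℕ._≤ #below i) (sym (#from-∉Δ i Δi)) (excluded⇒after<below i Δi))
    ... | true with last-or-next i
    ...   | inj₁ i-last = inj₂ (trans (#from-∈Δ i Δi) (#after-last i i-last))
    ...   | inj₂ (i′ , i′≡) with IH i′ i′≡
    ...     | inj₁ from≤below = inj₁ (begin
                #from i   ≡⟨ trans (#from-∈Δ i Δi) (#after-next i i′ i′≡) ⟩
                #from i′  ≤⟨ from≤below ⟩
                #below i′ ≤⟨ #below-mono (d↓ i i′ (subst (toℕ i ℕ.≤_) (sym i′≡) (ℕP.n≤1+n _))) ⟩
                #below i  ∎)
      where open ℕP.≤-Reasoning
    ...     | inj₂ from≡0 = inj₂ (trans (#from-∈Δ i Δi) (trans (#after-next i i′ i′≡) from≡0))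

  rank-From : ∀ {i j} → j F.≤ i → rank (From j) i ≡ #from i
  rank-From {i} {j} j≤i = count-cong
    (λ i′ t → let i′∈From , i≤i′ = T-∧⁻ {From j i′} t in T-∧⁺ (proj₁ (T-∧⁻ {not (Δ i′)} i′∈From)) i≤i′)
    (λ i′ t → let i′∉Δ , i≤i′ = T-∧⁻ {not (Δ i′)} t in
              T-∧⁺ (T-∧⁺ i′∉Δ (≤⇒≤ᶠ j i′ (ℕP.≤-trans j≤i (≤ᶠ⇒≤ i i′ i≤i′)))) i≤i′)

  countBelow-Below : ∀ {i j} → d i ℤ.≤ d j → countBelow (Below j) c (d i) ≡ #below i
  countBelow-Below {i} {j} di≤dj = count-cong
    (λ l t → let l∈Below , cl<di = T-∧⁻ {Below j l} t in T-∧⁺ (proj₁ (T-∧⁻ {S l} l∈Below)) cl<di)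
    (λ l t → T-∧⁺ (Below-mono di≤dj l t) (proj₂ (T-∧⁻ {S l} t)))

  rank-From≤countBelow : ∀ j i → T (From j i) → rank (From j) i ℕ.≤ countBelow (Below j) c (d i)
  rank-From≤countBelow j i i∈From = begin
    rank (From j) i                 ≡⟨ rank-From j≤i ⟩
    #from i                         ≡⟨ #from-∉Δ i i∉Δ ⟩
    suc (#after i)                  ≤⟨ excluded⇒after<below i i∉Δ ⟩
    #below i                        ≡⟨ sym (countBelow-Below (d↓ j i j≤i)) ⟩
    countBelow (Below j) c (d i)    ∎
    where
    open ℕP.≤-Reasoning
    i∉Δ : Δ i ≡ false
    i∉Δ = Equivalence.to T-not-≡ (proj₁ (T-∧⁻ {not (Δ i)} i∈From))
    j≤i : j F.≤ i
    j≤i = ≤ᶠ⇒≤ j i (proj₂ (T-∧⁻ {not (Δ i)} i∈From))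

  -- The tie makes q_j = s, so the tail sum of the a's in rule (b) is empty.
  rule-b-rhs≡ : ∀ j → Δ j ≡ false → #below j ≡ suc (#after j) → ∀ w → tailSum a (At.q j) ≡ just w →
                sumOver (At.after j) d + d j + w ≡ sumWhere (From j) d
  rule-b-rhs≡ j j∉Δ tie w tail = begin
    sumOver after d + d j + w        ≡⟨ trans (cong (λ v → sumOver after d + d j + v) w≡0) (ℤP.+-identityʳ _) ⟩
    sumOver after d + d j            ≡⟨ ℤP.+-comm _ (d j) ⟩
    d j + sumOver after d            ≡⟨ cong (λ v → d j + v) (sumOver≡sumWhere after d) ⟩
    d j + sumWhere after d           ≡⟨ cong (λ v → d j + v) (sumWhere-cong d after≡From∖j) ⟩
    d j + sumWhere (From j ∖ j) d    ≡⟨ sym (sumWhere-remove (From j) d (j∈From j j∉Δ)) ⟩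
    sumWhere (From j) d              ∎
    where
    open At j
    open ≡-Reasoning
    after≡From∖j : ∀ i → after i ≡ (From j ∖ j) i
    after≡From∖j i = trans (after≡ i) (T-injective (After⊆From∖j j i) (From∖j⊆After j i))
    q≡s : q ≡ + s
    q≡s = trans q≡ (trans (cong (λ A → qValue s A (#after j)) tie) (qValue-suc s (#after j)))
    w≡0 : w ≡ + 0
    w≡0 = begin
      w                                     ≡⟨ just-injective (trans (sym tail) (cong (tailSum a) q≡s)) ⟩
      sumOver (λ i → s ℕ.≤ᵇ toℕ i) a        ≡⟨ sumOver≡sumWhere _ a ⟩
      sumWhere (λ i → s ℕ.≤ᵇ toℕ i) a       ≡⟨ sumWhere-empty a (λ i s≤i → ℕP.<⇒≱ (FP.toℕ<n i) (ℕP.≤ᵇ⇒≤ s (toℕ i) s≤i)) ⟩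
      + 0                                   ∎

  rule-b-impossible : ∀ j → Δ j ≡ false → #below j ≡ suc (#after j) → ∀ w → tailSum a (At.q j) ≡ just w →
                      sumOver (At.after j) d + d j + w ℤ.≤ sumOver (At.below j) c → ⊥
  rule-b-impossible j j∉Δ tie w tail rhs≤lhs = ℤP.<⇒≱ Below<From From≤Below
    where
    open At j
    From≤Below : sumWhere (From j) d ℤ.≤ sumWhere (Below j) c
    From≤Below = subst₂ ℤ._≤_ (rule-b-rhs≡ j j∉Δ tie w tail) (trans (sumOver≡sumWhere below c) (sumWhere-cong c below≡))
                        rhs≤lhs
    Below<From : sumWhere (Below j) c ℤ.< sumWhere (From j) d
    Below<From = proj₂ (sumWhere-dominated d (From j) c (Below j) d↓
                                           (ℕP.≤-reflexive (trans tie (sym (#from-∉Δ j j∉Δ))))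
                                           (rank-From≤countBelow j))
                       (count-pos (From j) (j∈From j j∉Δ))

  module Threshold {γ : ℤ} {l₀ : Fin n} (S-l₀ : T (S l₀)) (c-l₀ : c l₀ ≡ γ)
                   (γ≤S : ∀ l → T (S l) → γ ℤ.≤ c l) (hs : 0 ℕ.< s) (aₛ≤γ : a (lastIx hs) ℤ.≤ γ) where

    rule-a-N-small : ∀ j → #below j ≡ suc (#after j) → ∀ l → T (At.below j l) →
                     At.N j l ℤ.≤ + count (λ i → (j <ᶠ i) ∧ (c l <ℤᵇ d i))
    rule-a-N-small j tie l l∈below = N-bound α<s (ℕP.≤-trans β≤after after≤W+γ′)
      where
      open At j
      Sσ = State.S σ
      Δσ = State.Δ σ
      cl<dj : c l ℤ.< d j
      cl<dj = <ℤᵇ⇒< (proj₂ (T-∧⁻ {Sσ l} l∈below))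
      α<s : cnt (λ i → c l <ℤᵇ a i) ℕ.< s
      α<s = subst (ℕ._< s) (sym (cnt≡count (λ i → c l <ℤᵇ a i)))
                  (count<-if-last-excluded hs (λ i → c l <ℤᵇ a i)
                                           (λ cl<aₛ → ℤP.<⇒≱ (<ℤᵇ⇒< cl<aₛ) (ℤP.≤-trans aₛ≤γ (γ≤S l Sl))))
        where
        Sl : T (S l)
        Sl = subst T (S-settled l cl<dj) (proj₁ (T-∧⁻ {Sσ l} l∈below))
      later⊆below∖l : (λ i → Sσ i ∧ (l <ᶠ i)) ⊆ (below ∖ l)
      later⊆below∖l i t = let Sσi , l<i = T-∧⁻ {Sσ i} t in
        T-∧⁺ (T-∧⁺ Sσi (<⇒<ℤᵇ (ℤP.≤-<-trans (c↓ l i (ℕP.<⇒≤ (<ᶠ⇒< l i l<i))) cl<dj)))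
             (T-not⁺ (λ i≡l → ℕP.<-irrefl (cong toℕ (sym (==ᶠ⇒≡ i l i≡l))) (<ᶠ⇒< l i l<i)))
      β≤after : cnt (λ i → Sσ i ∧ (l <ᶠ i)) ℕ.≤ #after j
      β≤after = begin
        cnt (λ i → Sσ i ∧ (l <ᶠ i))      ≡⟨ cnt≡count (λ i → Sσ i ∧ (l <ᶠ i)) ⟩
        count (λ i → Sσ i ∧ (l <ᶠ i))    ≤⟨ count-mono later⊆below∖l ⟩
        count (below ∖ l)                ≡⟨ ℕP.suc-injective (trans (sym (count-remove below l∈below))
                                                              (trans (sym (cnt≡count below)) (trans cnt-below tie))) ⟩
        #after j                         ∎
        where open ℕP.≤-Reasoning
      split : ∀ i → T (After j i) → T ((j <ᶠ i) ∧ (c l <ℤᵇ d i)) ⊎ T (not (Δσ i) ∧ (d i <ℤᵇ c l))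
      split i t with T-∧⁻ {j <ᶠ i} t | ℤP.<-cmp (c l) (d i)
      ... | j<i , _ | tri< cl<di _ _ = inj₁ (T-∧⁺ j<i (<⇒<ℤᵇ cl<di))
      ... | _ | tri≈ _ cl≡di _ = ⊥-elim (c≢d l i cl≡di)
      ... | j<i , i∉Δ | tri> _ _ di<cl =
        inj₂ (T-∧⁺ (subst (T ∘ not) (sym (Δ-settled i (<ᶠ⇒< j i j<i))) i∉Δ) (<⇒<ℤᵇ di<cl))
      after≤W+γ′ : #after j ℕ.≤ count (λ i → (j <ᶠ i) ∧ (c l <ℤᵇ d i))
                                ℕ.+ cnt (λ i → not (Δσ i) ∧ (d i <ℤᵇ c l))
      after≤W+γ′ = subst (#after j ℕ.≤_) (cong (count (λ i → (j <ᶠ i) ∧ (c l <ℤᵇ d i)) ℕ.+_)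
                                                (sym (cnt≡count (λ i → not (Δσ i) ∧ (d i <ℤᵇ c l)))))
                         (count-union split)

    no-tie : ∀ j → Δ j ≡ false → #below j ≡ suc (#after j) → ⊥
    no-tie j j∉Δ tie with At.excluded⇒exclusion j (trans (sym (At.Δ-decided j)) j∉Δ)
    ... | At.by-rule-a l l∈below ruleA =
      ℕP.<-irrefl refl (ℤP.drop‿+≤+ (ℤP.≤-trans (At.condA⇒N-large j l ruleA) (rule-a-N-small j tie l l∈below)))
    ... | At.by-rule-b w tail rhs≤lhs = rule-b-impossible j j∉Δ tie w tail rhs≤lhs

    l₀∈Below : ∀ {j} → γ ℤ.< d j → T (Below j l₀)
    l₀∈Below γ<dj = T-∧⁺ S-l₀ (<⇒<ℤᵇ (subst (ℤ._< _) (sym c-l₀) γ<dj))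

    #below-jump : ∀ {i j} → d i ℤ.< γ → γ ℤ.< d j → #below i ℕ.< #below j
    #below-jump di<γ γ<dj = count-strict (Below-mono (ℤP.<⇒≤ (ℤP.<-trans di<γ γ<dj))) (l₀∈Below γ<dj)
      (λ t → ℤP.<-asym di<γ (subst (ℤ._< _) c-l₀ (<ℤᵇ⇒< (proj₂ (T-∧⁻ {S l₀} t)))))

    after<below : ∀ j → γ ℤ.< d j → (∀ j′ → toℕ j′ ≡ suc (toℕ j) → γ ℤ.< d j′ → #from j′ ℕ.< #below j′) →
                  #after j ℕ.< #below j
    after<below j γ<dj IH with last-or-next j
    ... | inj₁ j-last = subst (ℕ._< #below j) (sym (#after-last j j-last)) (count-pos (Below j) (l₀∈Below γ<dj))
    ... | inj₂ (j′ , j′≡) with ℤP.<-cmp γ (d j′)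
    ...   | tri< γ<dj′ _ _ = begin-strict
            #after j   ≡⟨ #after-next j j′ j′≡ ⟩
            #from j′   <⟨ IH j′ j′≡ γ<dj′ ⟩
            #below j′  ≤⟨ #below-mono dj′≤dj ⟩
            #below j   ∎
      where open ℕP.≤-Reasoning
            dj′≤dj = d↓ j j′ (subst (toℕ j ℕ.≤_) (sym j′≡) (ℕP.n≤1+n _))
    ...   | tri≈ _ γ≡dj′ _ = ⊥-elim (c≢d l₀ j′ (trans c-l₀ γ≡dj′))
    ...   | tri> _ _ dj′<γ with #from≤#below j′
    ...     | inj₁ from≤below = begin-strict
              #after j   ≡⟨ #after-next j j′ j′≡ ⟩
              #from j′   ≤⟨ from≤below ⟩
              #below j′  <⟨ #below-jump dj′<γ γ<dj ⟩
              #below j   ∎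
      where open ℕP.≤-Reasoning
    ...     | inj₂ from≡0 =
      subst (ℕ._< #below j) (sym (trans (#after-next j j′ j′≡) from≡0)) (count-pos (Below j) (l₀∈Below γ<dj))

    from<below : ∀ j → γ ℤ.< d j → #from j ℕ.< #below j
    from<below = Fin-downward-induction (λ j → γ ℤ.< d j → #from j ℕ.< #below j) induction-step
      where
      induction-step : ∀ j → (∀ j′ → toℕ j′ ≡ suc (toℕ j) → γ ℤ.< d j′ → #from j′ ℕ.< #below j′) →
                       γ ℤ.< d j → #from j ℕ.< #below j
      induction-step j IH γ<dj with Δ j in Δj | ℕP.m≤n⇒m<n∨m≡n (after<below j γ<dj IH)
      ... | true | _ = subst (ℕ._< #below j) (sym (#from-∈Δ j Δj)) (after<below j γ<dj IH)
      ... | false | inj₁ 1+after<below = subst (ℕ._< #below j) (sym (#from-∉Δ j Δj)) 1+after<below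
      ... | false | inj₂ 1+after≡below = ⊥-elim (no-tie j Δj (sym 1+after≡below))

    qd-bounds : ∀ j → γ ℤ.< d j → qd j ℤ.≤ + s × (Δ j ≡ false → qd j ℤ.< + s)
    qd-bounds j γ<dj =
        subst (ℤ._≤ + s) (sym (qd≡ j)) (<⇒qValue≤ s _ _ (ℕP.≤-<-trans (count-mono (After⊆From j)) (from<below j γ<dj)))
      , λ j∉Δ → subst (ℤ._< + s) (sym (qd≡ j))
                  (<⇒qValue< s _ _ (subst (ℕ._< #below j) (#from-∉Δ j j∉Δ) (from<below j γ<dj)))

lemma3p10 : (m n s k : ℕ) → 0 ℕ.< m → 0 ℕ.< n → (hs : 0 ℕ.< s) → 0 ℕ.< k → m ℕ.+ s ≡ n ℕ.+ k →
    (a : Fin s → ℤ) (d : Fin m → ℤ) (b : Fin k → ℤ) (c : Fin n → ℤ) →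
    Partition a → Partition d → Partition b → Partition c →
    (∀ (i : Fin n) (j : Fin m) → c i ≢ d j) →
    cLast c (State.S (construction a d b c)) ≥∞ a (lastIx hs) →
    (j : Fin m) → d j >∞ cLast c (State.S (construction a d b c)) →
    (State.qd (construction a d b c) j ℤ.≤ + s)
      × (State.Δ (construction a d b c) j ≡ false → State.qd (construction a d b c) j ℤ.< + s)
lemma3p10 m n s k _ _ hs _ _ a d b c _ d↓ _ c↓ c≢d aₛ≤cLast j cLast<dj
  with cLast c (State.S (construction a d b c)) in cLast≡
... | just γ with cLast-spec c↓ cLast≡
... | l₀ , S-l₀ , c-l₀ , γ≤S = Threshold.qd-bounds S-l₀ c-l₀ γ≤S hs aₛ≤cLast j cLast<dj
  where open Construction a d b c c↓ d↓ c≢d
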